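{- Let $\mathcal{O}\subset T([n])$ be a nonempty finite order ideal and $I=T([n])\setminus\mathcal{O}$. Suppose $I$ is a disjoint union $I=\bigcup_{j=1}^m u_jT(S_j)$ with $u_j=x^{\alpha_j}\in I$ and $S_j\subseteq[n]$ (possibly empty), and suppose this partition is admissible for $\mathcal{O}$, i.e. for every $j$ and every $\beta\in\mathbb{N}^n$ whose support is contained in $S_j$ one has $\mathrm{ind}_{\mathcal{O}}(u_jx^\beta)=\mathrm{ind}_{\mathcal{O}}(u_j)+|\beta|$. Then \[\mathrm{Ind}_{\mathcal{O}}(y_1,\dots,y_n)=\sum_{j=1}^m y^{\alpha_j}\,P_{|S_j|}\big(\{y_\ell:\ell\in S_j\};1,\dots,1;\mathrm{ind}_{\mathcal{O}}(u_j)\big).\]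
   Context: $T([n])=\{x^\alpha:\alpha\in\mathbb{N}^n\}$; for $S\subseteq[n]$, $T(S)=\{x^\alpha:\alpha_i=0\text{ for } i\notin S\}$ (so $T(\emptyset)=\{1\}$); $T([n])_k$ is the set of power products of degree $k$, and $|\beta|=\sum\beta_i$. An order ideal is a set of power products closed under division. For an order ideal $\mathcal{O}$: $\partial\mathcal{O}=(T([n])_1\mathcal{O})\setminus\mathcal{O}$, $\overline{\partial\mathcal{O}}=\partial\mathcal{O}\cup\mathcal{O}$, $\overline{\partial^0\mathcal{O}}=\mathcal{O}$, $\partial^k\mathcal{O}=\partial(\overline{\partial^{k-1}\mathcal{O}})$, $\overline{\partial^k\mathcal{O}}=\partial^k\mathcal{O}\cup\overline{\partial^{k-1}\mathcal{O}}$; $\mathrm{ind}_{\mathcal{O}}(t)$ is the least $k$ with $t\in\overline{\partial^k\mathcal{O}}$, and $\mathrm{Ind}_{\mathcal{O}}(y)=\sum_{\alpha\in\mathbb{N}^n}\mathrm{ind}_{\mathcal{O}}(x^\alpha)y^\alpha$. For $k\ge1$ and variables $z_1,\dots,z_k$, $P_k(z_1,\dots,z_k;1,\dots,1;b)=\sum_{\gamma\in\mathbb{N}^k}(|\gamma|+b)z^\gamma$, and $P_0(;;b)=b$. -}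

module Defs where

open import Data.Nat using (ℕ; zero; suc; _+_; _∸_; _≤_; _≤ᵇ_)
open import Data.Bool using (Bool; true; false; _∨_; _∧_; if_then_else_; not)
open import Data.Fin using (Fin)
open import Data.Vec using (Vec; []; _∷_; lookup; zipWith; updateAt; foldr)
open import Data.Vec.Properties using (≡-dec)
open import Data.Nat.Properties using (_≟_)
open import Data.List using (List; []; _∷_; allFin; map)
open import Data.Bool.ListAction using (any)
open import Data.Nat.ListAction using (sum)
import Data.List.Membership.DecPropositional as DecMem
open import Relation.Nullary.Decidable using (⌊_⌋)
open import Data.Product using (Σ; _×_)
open import Relation.Binary.PropositionalEquality using (_≡_)

_∈?_ : ∀ {n} (α : Vec ℕ n) (O : List (Vec ℕ n)) → _
_∈?_ {n} = DecMem._∈?_ (≡-dec {n = n} _≟_)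

-- Exponent vectors α ∈ ℕⁿ (representing power products x^α).
Exp : ℕ → Set
Exp n = Vec ℕ n

deg : ∀ {n} → Exp n → ℕ
deg = foldr _ _+_ 0

_⊕_ : ∀ {n} → Exp n → Exp n → Exp n
_⊕_ = zipWith _+_

_∣ₑ_ : ∀ {n} → Exp n → Exp n → Set
β ∣ₑ α = ∀ i → lookup β i ≤ lookup α i

divB : ∀ {n} → Exp n → Exp n → Bool
divB [] [] = true
divB (b ∷ β) (a ∷ α) = (b ≤ᵇ a) ∧ divB β α

-- A subset S ⊆ [n] as a characteristic vector.
Sub : ℕ → Set
Sub n = Vec Bool n

card : ∀ {n} → Sub n → ℕ
card [] = 0
card (true ∷ S) = suc (card S)
card (false ∷ S) = card S

SuppIn : ∀ {n} → Sub n → Exp n → Set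
SuppIn S β = ∀ i → lookup S i ≡ false → lookup β i ≡ 0

suppInB : ∀ {n} → Sub n → Exp n → Bool
suppInB [] [] = true
suppInB (true ∷ S) (_ ∷ β) = suppInB S β
suppInB (false ∷ S) (b ∷ β) = ⌊ b ≟ 0 ⌋ ∧ suppInB S β

restrict : ∀ {n} (S : Sub n) → Exp n → Exp (card S)
restrict [] [] = []
restrict (true ∷ S) (b ∷ β) = b ∷ restrict S β
restrict (false ∷ S) (_ ∷ β) = restrict S β

InCone : ∀ {n} → Exp n → Sub n → Exp n → Set
InCone u S α = Σ (Exp _) λ β → SuppIn S β × (α ≡ u ⊕ β)

-- Finite order ideals, given as finite lists of exponents

_∈O_ : ∀ {n} → Exp n → List (Exp n) → Set
α ∈O O = ⌊ α ∈? O ⌋ ≡ true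

IsOrderIdeal : ∀ {n} → List (Exp n) → Set
IsOrderIdeal O = ∀ α β → α ∈O O → β ∣ₑ α → β ∈O O

-- Membership in the closure  \overline{∂^k O}:
--   \overline{∂^0 O} = O,
--   \overline{∂^{k+1} O} = T([n])_1 · \overline{∂^k O} ∪ \overline{∂^k O}.
inCl : ∀ {n} → List (Exp n) → ℕ → Exp n → Bool
inCl O zero t = ⌊ t ∈? O ⌋
inCl {n} O (suc k) t =
  inCl O k t ∨ any (λ i → not ⌊ lookup t i ≟ 0 ⌋ ∧ inCl O k (updateAt t i (_∸ 1))) (allFin n)

-- least k ≤ N with p k ≡ true (N if none)
least : (ℕ → Bool) → ℕ → ℕ
least p zero = 0
least p (suc N) = if p 0 then 0 else suc (least (λ k → p (suc k)) N)

-- ind_O(t): least k with t ∈ \overline{∂^k O}. For a nonempty order ideal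
-- 1 ∈ O, hence t ∈ \overline{∂^{deg t} O}, so searching k ≤ deg t suffices.
ind : ∀ {n} → List (Exp n) → Exp n → ℕ
ind O t = least (λ k → inCl O k t) (deg t)

-- Formal power series in y_1..y_n with ℕ coefficients, as coefficient maps.

Series : ℕ → Set
Series n = Exp n → ℕ

IndS : ∀ {n} → List (Exp n) → Series n
IndS O α = ind O α

-- P_k(z_1..z_k;1..1;b) = Σ_γ (|γ| + b) z^γ   (P_0 = b)
P : (k : ℕ) → ℕ → Series k
P k b γ = deg γ + b

-- substitute z_1..z_|S| ↦ (y_ℓ)_{ℓ ∈ S} (in increasing order of ℓ)
substS : ∀ {n} (S : Sub n) → Series (card S) → Series n
substS S F α = if suppInB S α then F (restrict S α) else 0

monoMul : ∀ {n} → Exp n → Series n → Series n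
monoMul a F α = if divB a α then F (zipWith _∸_ α a) else 0

sumS : ∀ {n} (m : ℕ) → (Fin m → Series n) → Series n
sumS m F α = sum (map (λ j → F j α) (allFin m))

module Submission where

-- The j-th summand is a series supported exactly on the cone u_j·T(S_j),
-- whose coefficient at u_j·x^β (supp β ⊆ S_j) is |β| + ind_O(u_j).  So at an
-- exponent α:
--  * if x^α ∈ O, no cone contains α (the cones lie in I), every summand
--    vanishes, and ind_O(x^α) = 0 because x^α ∈ \overline{∂^0 O} = O;
--  * if x^α ∉ O, the covering gives α = u_j ⊕ β with supp β ⊆ S_j, the
--    disjointness kills every other summand, and admissibility turns the
--    surviving coefficient |β| + ind_O(u_j) into ind_O(x^α).

open import Defs
open import Data.Nat using (ℕ; zero; suc; _+_; _∸_)
open import Data.Nat.Properties using (≤ᵇ⇒≤; ≤⇒≤ᵇ; m+[n∸m]≡n; m+n∸m≡n; m≤m+n; +-comm; +-identityʳ)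
open import Data.Fin using (Fin; zero; suc)
open import Data.Fin.Properties using (suc-injective)
open import Data.List using (List; tabulate)
open import Data.List.Properties using (map-tabulate)
open import Data.Nat.ListAction using (sum)
open import Data.Vec using ([]; _∷_; zipWith)
open import Data.Bool using (true; false)
open import Data.Bool.Properties using (∧-conicalˡ; ∧-conicalʳ; T-≡) renaming (_≟_ to _≟ᵇ_)
open import Data.Empty using (⊥-elim)
open import Data.Product using (Σ; _,_)
open import Function.Bundles using (Equivalence)
open import Relation.Nullary using (¬_; Dec; yes; no)
open import Relation.Nullary.Decidable using (⌊_⌋)
open import Relation.Binary.PropositionalEquality using (_≡_; _≢_; refl; sym; trans; cong; cong₂; module ≡-Reasoning)

-- Componentwise truncated difference: the quotient x^α / x^a whenever x^a ∣ x^α.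
_⊖_ : ∀ {n} → Exp n → Exp n → Exp n
_⊖_ = zipWith _∸_

coneSeries : ∀ {n} → Exp n → (S : Sub n) → ℕ → Series n
coneSeries a S b = monoMul a (substS S (P (card S) b))

summand : ∀ {n m} → List (Exp n) → (Fin m → Exp n) → (Fin m → Sub n) → Fin m → Series n
summand O u S j = coneSeries (u j) (S j) (ind O (u j))

divB-sound : ∀ {n} (a α : Exp n) → divB a α ≡ true → α ≡ a ⊕ (α ⊖ a)
divB-sound [] [] _ = refl
divB-sound (b ∷ a) (c ∷ α) ok =
  cong₂ _∷_ (sym (m+[n∸m]≡n (≤ᵇ⇒≤ b c (Equivalence.from T-≡ (∧-conicalˡ _ _ ok)))))
            (divB-sound a α (∧-conicalʳ _ _ ok))

divB-complete : ∀ {n} (a β : Exp n) → divB a (a ⊕ β) ≡ true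
divB-complete [] [] = refl
divB-complete (b ∷ a) (c ∷ β)
  rewrite Equivalence.to T-≡ (≤⇒≤ᵇ (m≤m+n b c)) = divB-complete a β

⊕-⊖-cancel : ∀ {n} (a β : Exp n) → (a ⊕ β) ⊖ a ≡ β
⊕-⊖-cancel [] [] = refl
⊕-⊖-cancel (b ∷ a) (c ∷ β) = cong₂ _∷_ (m+n∸m≡n b c) (⊕-⊖-cancel a β)

suppInB-sound : ∀ {n} (S : Sub n) (β : Exp n) → suppInB S β ≡ true → SuppIn S β
suppInB-sound (true ∷ S) (b ∷ β) ok zero ()
suppInB-sound (true ∷ S) (b ∷ β) ok (suc i) off = suppInB-sound S β ok i off
suppInB-sound (false ∷ S) (zero ∷ β) ok zero off = refl
suppInB-sound (false ∷ S) (zero ∷ β) ok (suc i) off = suppInB-sound S β ok i off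

suppInB-complete : ∀ {n} (S : Sub n) (β : Exp n) → SuppIn S β → suppInB S β ≡ true
suppInB-complete [] [] _ = refl
suppInB-complete (true ∷ S) (b ∷ β) supp = suppInB-complete S β (λ i → supp (suc i))
suppInB-complete (false ∷ S) (b ∷ β) supp with supp zero refl
... | refl = suppInB-complete S β (λ i → supp (suc i))

deg-restrict : ∀ {n} (S : Sub n) (β : Exp n) → SuppIn S β → deg (restrict S β) ≡ deg β
deg-restrict [] [] _ = refl
deg-restrict (true ∷ S) (b ∷ β) supp = cong (b +_) (deg-restrict S β (λ i → supp (suc i)))
deg-restrict (false ∷ S) (b ∷ β) supp with supp zero refl
... | refl = deg-restrict S β (λ i → supp (suc i))

shifted-off-cone : ∀ {n} (a : Exp n) (S : Sub n) (F : Series (card S)) α →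
  ¬ InCone a S α → monoMul a (substS S F) α ≡ 0
shifted-off-cone a S F α notInCone with divB a α in divides
... | false = refl
... | true with suppInB S (α ⊖ a) in supported
...   | false = refl
...   | true = ⊥-elim (notInCone (α ⊖ a , suppInB-sound S _ supported , divB-sound a α divides))

shifted-on-cone : ∀ {n} (a : Exp n) (S : Sub n) (F : Series (card S)) β →
  SuppIn S β → monoMul a (substS S F) (a ⊕ β) ≡ F (restrict S β)
shifted-on-cone a S F β supp
  rewrite divB-complete a β | ⊕-⊖-cancel a β | suppInB-complete S β supp = refl

coneSeries-off-cone : ∀ {n} (a : Exp n) (S : Sub n) b α →
  ¬ InCone a S α → coneSeries a S b α ≡ 0
coneSeries-off-cone a S b = shifted-off-cone a S (P (card S) b)

coneSeries-on-cone : ∀ {n} (a : Exp n) (S : Sub n) b β →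
  SuppIn S β → coneSeries a S b (a ⊕ β) ≡ deg β + b
coneSeries-on-cone a S b β supp =
  trans (shifted-on-cone a S (P (card S) b) β supp) (cong (_+ b) (deg-restrict S β supp))

sum-tabulate-zero : ∀ {m} (g : Fin m → ℕ) → (∀ k → g k ≡ 0) → sum (tabulate g) ≡ 0
sum-tabulate-zero {zero} g _ = refl
sum-tabulate-zero {suc m} g zeros
  rewrite zeros zero = sum-tabulate-zero (λ k → g (suc k)) (λ k → zeros (suc k))

sum-tabulate-single : ∀ {m} (g : Fin m → ℕ) j → (∀ k → k ≢ j → g k ≡ 0) → sum (tabulate g) ≡ g j
sum-tabulate-single {suc m} g zero others
  rewrite sum-tabulate-zero (λ k → g (suc k)) (λ k → others (suc k) (λ ())) = +-identityʳ (g zero)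
sum-tabulate-single {suc m} g (suc j) others
  rewrite others zero (λ ()) =
  sum-tabulate-single (λ k → g (suc k)) j (λ k k≢j → others (suc k) (λ e → k≢j (suc-injective e)))

sumS-zero : ∀ {n} m (F : Fin m → Series n) α → (∀ k → F k α ≡ 0) → sumS m F α ≡ 0
sumS-zero m F α zeros
  rewrite map-tabulate {n = m} (λ k → k) (λ k → F k α) = sum-tabulate-zero (λ k → F k α) zeros

sumS-single : ∀ {n} m (F : Fin m → Series n) α j → (∀ k → k ≢ j → F k α ≡ 0) → sumS m F α ≡ F j α
sumS-single m F α j others
  rewrite map-tabulate {n = m} (λ k → k) (λ k → F k α) = sum-tabulate-single (λ k → F k α) j others

least-at-zero : ∀ p N → p 0 ≡ true → least p N ≡ 0
least-at-zero p zero _ = refl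
least-at-zero p (suc N) p0 rewrite p0 = refl

-- Members of O have index 0, since \overline{∂^0 O} = O.
ind-member : ∀ {n} {O : List (Exp n)} {α} → α ∈O O → ind O α ≡ 0
ind-member {α = α} α∈O = least-at-zero _ (deg α) α∈O

_∈O?_ : ∀ {n} (α : Exp n) (O : List (Exp n)) → Dec (α ∈O O)
α ∈O? O = ⌊ α ∈? O ⌋ ≟ᵇ true

mainTheorem5 : (n : ℕ) (O : List (Exp n)) → IsOrderIdeal O → Σ (Exp n) (λ α → α ∈O O) →
    (m : ℕ) (u : Fin m → Exp n) (S : Fin m → Sub n) →
    (∀ j → ¬ (u j ∈O O)) →
    (∀ α → ¬ (α ∈O O) → Σ (Fin m) (λ j → InCone (u j) (S j) α)) →
    (∀ α j → InCone (u j) (S j) α → ¬ (α ∈O O)) →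
    (∀ α j k → InCone (u j) (S j) α → InCone (u k) (S k) α → j ≡ k) →
    (∀ j β → SuppIn (S j) β → ind O (u j ⊕ β) ≡ ind O (u j) + deg β) →
    ∀ α → IndS O α ≡ sumS m (λ j → monoMul (u j) (substS (S j) (P (card (S j)) (ind O (u j))))) α
mainTheorem5 n O _ _ m u S _ cover conesInI disjoint admissible α with α ∈O? O
... | yes α∈O = trans (ind-member α∈O) (sym (sumS-zero m (summand O u S) α noCone))
  where
  noCone : ∀ k → summand O u S k α ≡ 0
  noCone k = coneSeries-off-cone (u k) (S k) _ α (λ c → conesInI α k c α∈O)
... | no α∉O with cover α α∉O
... | j , β , supp , refl = begin
  ind O (u j ⊕ β)                  ≡⟨ admissible j β supp ⟩
  ind O (u j) + deg β              ≡⟨ +-comm (ind O (u j)) (deg β) ⟩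
  deg β + ind O (u j)              ≡⟨ sym (coneSeries-on-cone (u j) (S j) _ β supp) ⟩
  summand O u S j (u j ⊕ β)        ≡⟨ sym (sumS-single m (summand O u S) _ j onlyCone) ⟩
  sumS m (summand O u S) (u j ⊕ β) ∎
  where
  open ≡-Reasoning
  onlyCone : ∀ k → k ≢ j → summand O u S k (u j ⊕ β) ≡ 0
  onlyCone k k≢j = coneSeries-off-cone (u k) (S k) _ _ (λ c → k≢j (disjoint _ k j c (β , supp , refl)))
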